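{- Let $T$ be a tree with diameter $d$ and diametrical path $P: v_0, v_1, \ldots, v_d$, and for each $i \in \{0,\ldots,d\}$ let $T_i$ be the subtree of $T$ induced by all vertices connected to $v_i$ by paths internally disjoint from $P$. If there exists $i \in \{2, \ldots, d-2\}$ such that $T_i$ has an independent set of cardinality $2$ that does not dominate $v_i$ (i.e., neither contains $v_i$ nor contains a neighbour of $v_i$), then $\Gamma_b(T) > \operatorname{diam}(T)$.
   Context: All graphs are finite, simple, connected and nontrivial. A diametrical path of a tree $T$ of diameter $d$ is a path $v_0,\ldots,v_d$ of length $d$. For a graph $G=(V,E)$, a broadcast is a function $f: V \to \{0,1,\ldots,\operatorname{diam}(G)\}$ with $f(v) \le e(v)$ (the eccentricity of $v$) for all $v$. It is dominating if every $u \in V$ is at distance at most $f(v)$ from some $v$ with $f(v) \ge 1$. It is minimal dominating if it is dominating and no broadcast $f' \ne f$ with $f'(v)\le f(v)$ for all $v$ is dominating. The cost of $f$ is $\sigma(f)=\sum_{v} f(v)$, and $\Gamma_b(G)=\max\{\sigma(f): f \text{ minimal dominating broadcast on } G\}$. -}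

module Defs where

open import Data.Nat using (ℕ; zero; suc; _+_; _≤_; _<_)
open import Data.Fin using (Fin; toℕ)
open import Data.Bool using (Bool; true; false)
open import Data.List using (List; []; _∷_; map; allFin; length; last)
open import Data.Nat.ListAction using (sum)
open import Data.Maybe using (just)
open import Data.List.Relation.Unary.Linked using (Linked)
open import Data.List.Relation.Unary.Unique.Propositional using (Unique)
open import Data.List.Relation.Unary.All using (All)

open import Data.Product using (Σ; ∃; _×_; _,_)
open import Relation.Binary.PropositionalEquality using (_≡_; _≢_)
open import Relation.Nullary using (¬_)

record Graph : Set where
  field
    n      : ℕ
    adj    : Fin n → Fin n → Bool
    sym    : ∀ u v → adj u v ≡ adj v u
    irrefl : ∀ u → adj u u ≡ false

open Graph public

module _ (G : Graph) where

  V : Set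
  V = Fin (n G)

  Adj : V → V → Set
  Adj u v = adj G u v ≡ true

  data Walk : V → V → ℕ → Set where
    here : ∀ {u} → Walk u u 0
    step : ∀ {u w v k} → Adj u w → Walk w v k → Walk u v (suc k)

  Within : V → V → ℕ → Set
  Within u v k = Σ ℕ λ m → m ≤ k × Walk u v m

  Dist : V → V → ℕ → Set
  Dist u v k = Within u v k × (∀ m → Within u v m → k ≤ m)

  Connected : Set
  Connected = ∀ u v → Σ ℕ λ k → Walk u v k

  Nontrivial : Set
  Nontrivial = 2 ≤ n G

  IsCycle : V → List V → Set
  IsCycle x xs =
    3 ≤ length (x ∷ xs) × Unique (x ∷ xs) × Linked Adj (x ∷ xs)
      × Σ V λ y → last (x ∷ xs) ≡ just y × Adj y x

  IsTree : Set
  IsTree = Connected × Nontrivial × (∀ x xs → ¬ IsCycle x xs)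

  Ecc : V → ℕ → Set
  Ecc v k = (∀ u → Within v u k) × (Σ V λ u → Dist v u k)

  Diam : ℕ → Set
  Diam d = (∀ u v k → Dist u v k → k ≤ d) × (Σ V λ u → Σ V λ v → Dist u v d)

  Broadcast : Set
  Broadcast = V → ℕ

  IsBroadcast : Broadcast → Set
  IsBroadcast f = ∀ v → Σ ℕ λ e → Ecc v e × f v ≤ e

  Dominating : Broadcast → Set
  Dominating f = ∀ u → Σ V λ v → 1 ≤ f v × Within v u (f v)

  MinimalDominating : Broadcast → Set
  MinimalDominating f =
    IsBroadcast f × Dominating f ×
    (∀ f' → IsBroadcast f' → (∀ v → f' v ≤ f v) → ¬ (∀ v → f' v ≡ f v)
          → ¬ Dominating f')

  cost : Broadcast → ℕ
  cost f = sum (map f (allFin (n G)))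

  -- Γ_b(G) > d  (Γ_b is the maximum cost of a minimal dominating broadcast)
  UpperBroadcastNumberExceeds : ℕ → Set
  UpperBroadcastNumberExceeds d = Σ Broadcast λ f → MinimalDominating f × d < cost f

  IsPathOfLength : (d : ℕ) → (Fin (suc d) → V) → Set
  IsPathOfLength d P =
    (∀ i j → P i ≡ P j → i ≡ j) ×
    (∀ (i : Fin d) → Adj (P (Data.Fin.inject₁ i)) (P (Data.Fin.suc i)))
    where import Data.Fin

  OnPath : ∀ {d} → (Fin (suc d) → V) → V → Set
  OnPath P x = Σ _ λ j → P j ≡ x

  InBranch : ∀ {d} → (Fin (suc d) → V) → Fin (suc d) → V → Set
  InBranch P i u =
    Σ (List V) λ xs → Unique (P i ∷ xs) × Linked Adj (P i ∷ xs)
      × All (λ x → ¬ OnPath P x) xs × last (P i ∷ xs) ≡ just u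

module Submission where

-- The broadcast h: v₀ with power about a = i-1, v_d with power about b = d-i, and
-- power 1 on a maximal independent set S, grown greedily from {x, y}, of the
-- vertices outside both balls B(v₀,a) and B(v_d,b).  If every vertex at distance
-- exactly a from v₀ is adjacent to S, the power of v₀ drops to a-1, and a member of
-- S adjacent to v_{i-1} witnesses this; symmetrically at v_d, with a witness adjacent
-- to v_i.  The witnesses differ from each other (a tree has no triangles) and from x
-- and y (which lie deep in T_i), so cost(h) ≥ a + b + 2 = d + 1.  Minimality and
-- validity hold because every broadcasting vertex has a private vertex.

open import Defs hiding (sym)
open import Data.Nat using (ℕ; zero; suc; _+_; _∸_; _≤_; _<_; z≤n; s≤s; _<?_; _≤?_)
open import Data.Nat.Properties
open import Data.Nat.ListAction using (sum)
open import Data.Fin using (Fin; toℕ; fromℕ<; inject₁) renaming (zero to fzero; suc to fsuc)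
import Data.Fin.Properties as FinP
open import Data.Bool using (true; if_then_else_)
import Data.Bool.Properties as BoolP
open import Data.List using (List; []; _∷_; _++_; allFin; length; last; tabulate)
open import Data.List.Properties using (map-tabulate; tabulate-cong; length-++)
open import Data.List.Extrema.Nat using (argmax; f[xs]≤f[argmax])
open import Data.Maybe using (just)
open import Data.List.Relation.Unary.Linked using (Linked; [-]; _∷_)
open import Data.List.Relation.Unary.AllPairs using ([]; _∷_)
open import Data.List.Relation.Unary.All as All using (All; []; _∷_)
import Data.List.Relation.Unary.All.Properties as AllP
open import Data.List.Relation.Unary.Any using (here; there)
import Data.List.Relation.Unary.Any as Any
open import Data.List.Relation.Unary.Unique.Propositional using (Unique)
import Data.List.Relation.Unary.Unique.Propositional.Properties as UniqueP
open import Data.List.Membership.Propositional using (_∈_; _∉_; find)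
open import Data.List.Membership.Propositional.Properties using (∈-allFin; ∈-++⁻)
open import Data.Product using (Σ; ∃; _×_; _,_; proj₁; proj₂)
open import Data.Sum using (_⊎_; inj₁; inj₂; [_,_]′)
open import Data.Empty using (⊥; ⊥-elim)
open import Function using (_∘_; id)
open import Relation.Binary.PropositionalEquality
open import Relation.Nullary using (Dec; yes; no; ¬_; ¬?; does)
open import Relation.Nullary.Decidable using (_×-dec_; decidable-stable)
open import Data.List.Relation.Binary.Disjoint.Propositional using (Disjoint)
open import Data.Nat.Tactic.RingSolver using (solve-∀)
open import Algebra.Properties.CommutativeSemigroup +-commutativeSemigroup using (interchange)

-- A decidable, upward closed property of naturals that holds somewhere has a
-- least witness; this turns "some walk of length ≤ k" into a distance.
least-witness : (Q : ℕ → Set) → (∀ k → Dec (Q k)) → (∀ {j k} → j ≤ k → Q j → Q k)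
              → ∀ k → Q k → Σ ℕ λ m → Q m × (∀ j → Q j → m ≤ j)
least-witness Q Q? mono zero q = zero , q , λ _ _ → z≤n
least-witness Q Q? mono (suc k) q with Q? k
... | yes q′ = least-witness Q Q? mono k q′
... | no ¬q = suc k , q , λ j qj → ≰⇒> (λ j≤k → ¬q (mono j≤k qj))

-- The initial segment of a list up to (and including) a given member; used to
-- cut a cycle out of a path that a walk returns to.
prefix-to : ∀ {A : Set} {w : A} (xs : List A) → w ∈ xs → List A
prefix-to (p ∷ ps) (here _) = p ∷ []
prefix-to (p ∷ ps) (there m) = p ∷ prefix-to ps m

prefix-to-last : ∀ {A : Set} {w : A} c xs (m : w ∈ xs) → last (c ∷ prefix-to xs m) ≡ just w
prefix-to-last c (p ∷ ps) (here eq) = cong just (sym eq)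
prefix-to-last c (p ∷ ps) (there m) = prefix-to-last p ps m

prefix-to-linked : ∀ {A : Set} {R : A → A → Set} {w : A} c xs (m : w ∈ xs)
                 → Linked R (c ∷ xs) → Linked R (c ∷ prefix-to xs m)
prefix-to-linked c (p ∷ ps) (here _) (r ∷ _) = r ∷ [-]
prefix-to-linked c (p ∷ ps) (there m) (r ∷ l) = r ∷ prefix-to-linked p ps m l

prefix-to-all : ∀ {A : Set} {Q : A → Set} {w : A} xs (m : w ∈ xs) → All Q xs → All Q (prefix-to xs m)
prefix-to-all (p ∷ ps) (here _) (q ∷ _) = q ∷ []
prefix-to-all (p ∷ ps) (there m) (q ∷ qs) = q ∷ prefix-to-all ps m qs

prefix-to-unique : ∀ {A : Set} {w : A} c xs (m : w ∈ xs) → Unique (c ∷ xs) → Unique (c ∷ prefix-to xs m)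
prefix-to-unique c (p ∷ ps) (here eq) (c∉ ∷ _) = prefix-to-all (p ∷ ps) (here eq) c∉ ∷ [] ∷ []
prefix-to-unique c (p ∷ ps) (there m) (c∉ ∷ u) =
  prefix-to-all (p ∷ ps) (there m) c∉ ∷ prefix-to-unique p ps m u

last-∈ : ∀ {A : Set} (x : A) xs {z} → last (x ∷ xs) ≡ just z → z ∈ x ∷ xs
last-∈ x [] refl = here refl
last-∈ x (x′ ∷ xs) e = there (last-∈ x′ xs e)

short-unique : ∀ {A : Set} (xs : List A) → length xs ≤ 1 → Unique xs
short-unique [] _ = []
short-unique (_ ∷ []) _ = [] ∷ []
short-unique (_ ∷ _ ∷ _) (s≤s ())

total : ∀ {n} → (Fin n → ℕ) → ℕ
total f = sum (tabulate f)

total-zero : ∀ n → total {n} (λ _ → 0) ≡ 0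
total-zero zero = refl
total-zero (suc n) = total-zero n

total-+ : ∀ {n} (f g : Fin n → ℕ) → total (λ v → f v + g v) ≡ total f + total g
total-+ {zero} f g = refl
total-+ {suc n} f g = begin
  f fzero + g fzero + total (λ v → f (fsuc v) + g (fsuc v))  ≡⟨ cong (f fzero + g fzero +_) (total-+ (f ∘ fsuc) (g ∘ fsuc)) ⟩
  f fzero + g fzero + (total (f ∘ fsuc) + total (g ∘ fsuc))  ≡⟨ interchange (f fzero) (g fzero) _ _ ⟩
  f fzero + total (f ∘ fsuc) + (g fzero + total (g ∘ fsuc))  ∎
  where open ≡-Reasoning

total-mono : ∀ {n} (f g : Fin n → ℕ) → (∀ v → f v ≤ g v) → total f ≤ total g
total-mono {zero} f g le = z≤n
total-mono {suc n} f g le = +-mono-≤ (le fzero) (total-mono (f ∘ fsuc) (g ∘ fsuc) (le ∘ fsuc))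

δ : ∀ {n} → Fin n → ℕ → Fin n → ℕ
δ c m v = if does (v FinP.≟ c) then m else 0

δ-at : ∀ {n} (c : Fin n) m → δ c m c ≡ m
δ-at c m with c FinP.≟ c
... | yes _ = refl
... | no c≢c = ⊥-elim (c≢c refl)

δ-off : ∀ {n} {c v : Fin n} m → v ≢ c → δ c m v ≡ 0
δ-off {c = c} {v} m v≢c with v FinP.≟ c
... | yes v≡c = ⊥-elim (v≢c v≡c)
... | no _ = refl

total-δ : ∀ {n} (c : Fin n) m → total (δ c m) ≡ m
total-δ {suc n} fzero m = trans (cong (m +_) (total-zero n)) (+-identityʳ m)
total-δ {suc n} (fsuc c) m = total-δ c m

ind : ∀ {n} → List (Fin n) → Fin n → ℕ
ind S v = if does (Any.any? (v FinP.≟_) S) then 1 else 0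

ind-in : ∀ {n} {S : List (Fin n)} {v} → v ∈ S → ind S v ≡ 1
ind-in {S = S} {v} v∈S with Any.any? (v FinP.≟_) S
... | yes _ = refl
... | no v∉S = ⊥-elim (v∉S v∈S)

ind-out : ∀ {n} {S : List (Fin n)} {v} → v ∉ S → ind S v ≡ 0
ind-out {S = S} {v} v∉S with Any.any? (v FinP.≟_) S
... | yes v∈S = ⊥-elim (v∉S v∈S)
... | no _ = refl

ind-cons : ∀ {n} {w : Fin n} {ws} → w ∉ ws → ∀ v → ind (w ∷ ws) v ≡ δ w 1 v + ind ws v
ind-cons {w = w} {ws} w∉ws v with v FinP.≟ w | Any.any? (v FinP.≟_) ws
... | yes refl | yes v∈ws = ⊥-elim (w∉ws v∈ws)
... | yes refl | no _ = refl
... | no _ | yes _ = refl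
... | no _ | no _ = refl

total-ind-unique : ∀ {n} (ws : List (Fin n)) → Unique ws → total (ind ws) ≡ length ws
total-ind-unique {n} [] _ = total-zero n
total-ind-unique (w ∷ ws) (w∉ ∷ u) = begin
  total (ind (w ∷ ws))                   ≡⟨ cong sum (tabulate-cong (ind-cons w∉ws)) ⟩
  total (λ v → δ w 1 v + ind ws v)       ≡⟨ total-+ (δ w 1) (ind ws) ⟩
  total (δ w 1) + total (ind ws)         ≡⟨ cong₂ _+_ (total-δ w 1) (total-ind-unique ws u) ⟩
  suc (length ws)                        ∎
  where
  open ≡-Reasoning
  w∉ws : w ∉ ws
  w∉ws w∈ws = All.lookup w∉ w∈ws refl

unique-count : ∀ {n} (ws S : List (Fin n)) → Unique ws → (∀ {w} → w ∈ ws → w ∈ S) → length ws ≤ total (ind S)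
unique-count ws S u ws⊆S = subst (_≤ total (ind S)) (total-ind-unique ws u) (total-mono (ind ws) (ind S) pointwise)
  where
  pointwise : ∀ v → ind ws v ≤ ind S v
  pointwise v with Any.any? (v FinP.≟_) ws
  ... | yes v∈ws = ≤-reflexive (sym (ind-in (ws⊆S v∈ws)))
  ... | no _ = z≤n

module GraphTheory (G : Graph) where

  Vertex : Set
  Vertex = V G

  _~_ : Vertex → Vertex → Set
  _~_ = Adj G

  Wi : Vertex → Vertex → ℕ → Set
  Wi = Within G

  ~-sym : ∀ {u v} → u ~ v → v ~ u
  ~-sym {u} {v} e = trans (Graph.sym G v u) e

  ~-irrefl : ∀ {u v} → u ~ v → u ≢ v
  ~-irrefl {u} e refl with trans (sym e) (Graph.irrefl G u)
  ... | ()

  _~?_ : ∀ u v → Dec (u ~ v)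
  u ~? v = adj G u v BoolP.≟ true

  walk-++ : ∀ {u v w j k} → Walk G u v j → Walk G v w k → Walk G u w (j + k)
  walk-++ here q = q
  walk-++ (step e p) q = step e (walk-++ p q)

  walk-reverse : ∀ {u v k} → Walk G u v k → Walk G v u k
  walk-reverse here = here
  walk-reverse {k = suc k} (step e p) =
    subst (Walk G _ _) (+-comm k 1) (walk-++ (walk-reverse p) (step (~-sym e) here))

  within-refl : ∀ {u} k → Wi u u k
  within-refl k = 0 , z≤n , here

  within-mono : ∀ {u v j k} → j ≤ k → Wi u v j → Wi u v k
  within-mono j≤k (m , m≤j , p) = m , ≤-trans m≤j j≤k , p

  within-trans : ∀ {u v w j k} → Wi u v j → Wi v w k → Wi u w (j + k)
  within-trans (m , m≤j , p) (m′ , m′≤k , q) = m + m′ , +-mono-≤ m≤j m′≤k , walk-++ p q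

  within-sym : ∀ {u v k} → Wi u v k → Wi v u k
  within-sym (m , m≤k , p) = m , m≤k , walk-reverse p

  within-zero : ∀ {u v} → Wi u v 0 → u ≡ v
  within-zero (zero , _ , here) = refl

  within-one : ∀ {u v} → Wi u v 1 → u ≡ v ⊎ u ~ v
  within-one (zero , _ , here) = inj₁ refl
  within-one (suc zero , _ , step e here) = inj₂ e
  within-one (suc (suc _) , s≤s () , _)

  ~⇒within-one : ∀ {u v} → u ~ v → Wi u v 1
  ~⇒within-one e = 1 , ≤-refl , step e here

  beyond : ∀ {c z J r} → (∀ {k} → Wi c z k → J + 2 ≤ k) → r ≤ J → ¬ Wi c z (suc r)
  beyond {J = J} {r} far r≤J w = <⇒≱ (subst (_≤ J + 2) (+-comm r 2) (+-monoˡ-≤ 2 r≤J)) (far w)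

  linked-walk : ∀ {a b} xs → Linked _~_ (a ∷ xs) → last (a ∷ xs) ≡ just b → Walk G a b (length xs)
  linked-walk [] _ refl = here
  linked-walk (x ∷ xs) (e ∷ l) eq = step e (linked-walk xs l eq)

  walk? : ∀ m u v → Dec (Walk G u v m)
  walk? zero u v with u FinP.≟ v
  ... | yes refl = yes here
  ... | no u≢v = no λ { here → u≢v refl }
  walk? (suc m) u v with FinP.any? (λ w → (u ~? w) ×-dec walk? m w v)
  ... | yes (w , e , p) = yes (step e p)
  ... | no none = no λ { (step e p) → none (_ , e , p) }

  within? : ∀ k u v → Dec (Wi u v k)
  within? zero u v with walk? 0 u v
  ... | yes p = yes (0 , z≤n , p)
  ... | no ¬p = no λ { (zero , _ , p) → ¬p p }
  within? (suc k) u v with within? k u v | walk? (suc k) u v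
  ... | yes (m , m≤k , p) | _ = yes (m , m≤n⇒m≤1+n m≤k , p)
  ... | no _ | yes p = yes (suc k , ≤-refl , p)
  ... | no ¬near | no ¬p = no λ (m , m≤1+k , p) →
          [ (λ m<1+k → ¬near (m , ≤-pred m<1+k , p)) , (λ { refl → ¬p p }) ]′ (m≤n⇒m<n∨m≡n m≤1+k)

  Heard : List Vertex → Vertex → Set
  Heard S u = Σ Vertex λ s → s ∈ S × Wi s u 1

  heard? : ∀ S u → Dec (Heard S u)
  heard? S u = FinP.any? (λ s → Any.any? (s FinP.≟_) S ×-dec within? 1 s u)

  module Distances (connected : Connected G) where

    distance : ∀ u v → Σ ℕ (Dist G u v)
    distance u v with connected u v
    ... | k , p = least-witness (Wi u v) (λ k → within? k u v) within-mono k (k , ≤-refl , p)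

    eccentricity : ∀ v → Σ ℕ (Ecc G v)
    eccentricity v = dist far , (λ u → within-mono (farthest u) (proj₁ (proj₂ (distance v u)))) , far , proj₂ (distance v far)
      where
      dist : Vertex → ℕ
      dist u = proj₁ (distance v u)
      far : Vertex
      far = argmax dist v (allFin (n G))
      farthest : ∀ u → dist u ≤ dist far
      farthest u = All.lookup (f[xs]≤f[argmax] v (allFin (n G))) (∈-allFin u)

    broadcast-within-eccentricity : (f : Broadcast G) → (∀ v → 1 ≤ f v → Σ Vertex λ u → ¬ Wi v u (f v ∸ 1))
                                  → IsBroadcast G f
    broadcast-within-eccentricity f reaches v with eccentricity v | 1 ≤? f v
    ... | e , ecc | no f≱1 = e , ecc , ≤-trans (≤-pred (≰⇒> f≱1)) z≤n
    ... | e , ecc | yes 1≤f with reaches v 1≤f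
    ...   | u , ¬near = e , ecc , ≮⇒≥ λ e<f → ¬near (within-mono (<⇒≤pred e<f) (proj₁ ecc u))

  Private : Broadcast G → Vertex → Vertex → Set
  Private h v u = (∀ w → 1 ≤ h w → Wi w u (h w) → w ≡ v) × (∀ k → 1 ≤ k → k < h v → ¬ Wi v u k)

  -- If every broadcasting vertex has a private vertex, lowering any power leaves
  -- that vertex's private vertex undominated.
  privates⇒minimal : (h : Broadcast G) → (∀ v → 1 ≤ h v → ∃ (Private h v))
                   → ∀ f → IsBroadcast G f → (∀ v → f v ≤ h v) → ¬ (∀ v → f v ≡ h v) → ¬ Dominating G f
  privates⇒minimal h privates f _ f≤h f≢h dominating
    with FinP.¬∀⟶∃¬ _ (λ v → f v ≡ h v) (λ v → f v ≟ h v) f≢h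
  ... | v , fv≢hv with privates v (≤-trans (s≤s z≤n) (≤∧≢⇒< (f≤h v) fv≢hv))
  ...   | u , only , far with dominating u
  ...     | w , 1≤fw , hears with only w (≤-trans 1≤fw (f≤h w)) (within-mono (f≤h w) hears)
  ...       | refl = far (f v) 1≤fw (≤∧≢⇒< (f≤h v) fv≢hv) hears

  another-vertex : Nontrivial G → (v : Vertex) → Σ Vertex λ u → u ≢ v
  another-vertex nontrivial v with n G | v | nontrivial
  ... | suc (suc _) | fzero | _ = fsuc fzero , λ ()
  ... | suc (suc _) | fsuc _ | _ = fzero , λ ()
  ... | suc zero | _ | s≤s ()

  private⇒reaches : Nontrivial G → (h : Broadcast G) → ∀ v → 1 ≤ h v → ∃ (Private h v)
                  → Σ Vertex λ u → ¬ Wi v u (h v ∸ 1)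
  private⇒reaches nontrivial h v 1≤hv (u , _ , far) with h v | 1≤hv
  ... | suc zero | _ with another-vertex nontrivial v
  ...   | u′ , u′≢v = u′ , λ w → u′≢v (sym (within-zero w))
  private⇒reaches nontrivial h v 1≤hv (u , _ , far) | suc (suc k) | _ = u , far (suc k) (s≤s z≤n) ≤-refl

  module Greedy (U : Vertex → Set) (U? : ∀ u → Dec (U u)) where

    IndependentIn : List Vertex → Set
    IndependentIn C = (∀ {c} → c ∈ C → U c) × (∀ {c c′} → c ∈ C → c′ ∈ C → ¬ c ~ c′)

    greedy : List Vertex → List Vertex → List Vertex
    greedy C [] = C
    greedy C (v ∷ vs) with U? v | Any.any? (λ c → c ~? v) C
    ... | yes _ | no _ = greedy (v ∷ C) vs
    ... | yes _ | yes _ = greedy C vs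
    ... | no _ | _ = greedy C vs

    greedy-⊇ : ∀ {c} C L → c ∈ C → c ∈ greedy C L
    greedy-⊇ C [] c∈C = c∈C
    greedy-⊇ C (v ∷ vs) c∈C with U? v | Any.any? (λ c → c ~? v) C
    ... | yes _ | no _ = greedy-⊇ (v ∷ C) vs (there c∈C)
    ... | yes _ | yes _ = greedy-⊇ C vs c∈C
    ... | no _ | _ = greedy-⊇ C vs c∈C

    greedy-independent : ∀ C L → IndependentIn C → IndependentIn (greedy C L)
    greedy-independent C [] ind = ind
    greedy-independent C (v ∷ vs) (inU , indep) with U? v | Any.any? (λ c → c ~? v) C
    ... | yes Uv | no no-nbr = greedy-independent (v ∷ C) vs (inU′ , indep′)
      where
      inU′ : ∀ {c} → c ∈ v ∷ C → U c
      inU′ (here refl) = Uv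
      inU′ (there c∈C) = inU c∈C
      indep′ : ∀ {c c′} → c ∈ v ∷ C → c′ ∈ v ∷ C → ¬ c ~ c′
      indep′ (here refl) (here refl) e = ~-irrefl e refl
      indep′ (here refl) (there c′∈C) e = no-nbr (Any.map (λ { refl → ~-sym e }) c′∈C)
      indep′ (there c∈C) (here refl) e = no-nbr (Any.map (λ { refl → e }) c∈C)
      indep′ (there c∈C) (there c′∈C) e = indep c∈C c′∈C e
    ... | yes _ | yes _ = greedy-independent C vs (inU , indep)
    ... | no _ | _ = greedy-independent C vs (inU , indep)

    greedy-maximal : ∀ C L {u} → u ∈ L → U u → u ∈ greedy C L ⊎ Σ Vertex λ c → c ∈ greedy C L × c ~ u
    greedy-maximal C (v ∷ vs) (there u∈vs) Uu with U? v | Any.any? (λ c → c ~? v) C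
    ... | yes _ | no _ = greedy-maximal (v ∷ C) vs u∈vs Uu
    ... | yes _ | yes _ = greedy-maximal C vs u∈vs Uu
    ... | no _ | _ = greedy-maximal C vs u∈vs Uu
    greedy-maximal C (v ∷ vs) (here refl) Uu with U? v | Any.any? (λ c → c ~? v) C
    ... | no ¬Uu | _ = ⊥-elim (¬Uu Uu)
    ... | yes _ | no _ = inj₁ (greedy-⊇ (v ∷ C) vs (here refl))
    ... | yes _ | yes nbr with find nbr
    ...   | c , c∈C , c~u = inj₂ (c , greedy-⊇ C vs c∈C , c~u)

  module Trees (acyclic : ∀ x xs → ¬ IsCycle G x xs) where

    no-triangle : ∀ {u v w} → u ~ v → v ~ w → w ~ u → ⊥
    no-triangle uv vw wu = acyclic _ (_ ∷ _ ∷ [])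
      ( ≤-refl
      , ((~-irrefl uv ∷ (λ eq → ~-irrefl wu (sym eq)) ∷ []) ∷ (~-irrefl vw ∷ []) ∷ [] ∷ [])
      , uv ∷ vw ∷ [-]
      , _ , refl , wu )

    -- By induction on the walk: its first step follows the
    -- path, closes a cycle with it, or extends the path backwards.
    path-shortest : ∀ {a b m} xs → Unique (a ∷ xs) → Linked _~_ (a ∷ xs) → last (a ∷ xs) ≡ just b
                  → Walk G a b m → length xs ≤ m
    path-shortest [] _ _ _ _ = z≤n
    path-shortest {a} (p ∷ ps) (a∉ ∷ _) _ e here = ⊥-elim (All.lookup a∉ (last-∈ p ps e) refl)
    path-shortest {a} (p ∷ ps) (a∉ ∷ u) (ap ∷ l) e (step {w = w} aw rest) with w FinP.≟ p
    ... | yes refl = s≤s (path-shortest ps u l e rest)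
    ... | no w≢p with Any.any? (w FinP.≟_) ps
    ...   | yes w∈ps = ⊥-elim (acyclic a (prefix-to (p ∷ ps) (there w∈ps))
              ( s≤s (s≤s (prefix-nonempty ps w∈ps))
              , prefix-to-unique a (p ∷ ps) (there w∈ps) (a∉ ∷ u)
              , prefix-to-linked a (p ∷ ps) (there w∈ps) (ap ∷ l)
              , w , prefix-to-last p ps w∈ps , ~-sym aw ))
      where
      prefix-nonempty : ∀ qs (m : w ∈ qs) → 1 ≤ length (prefix-to qs m)
      prefix-nonempty (_ ∷ _) (here _) = s≤s z≤n
      prefix-nonempty (_ ∷ _) (there _) = s≤s z≤n
    ...   | no w∉ps = ≤-trans (n≤1+n _) (≤-trans (path-shortest (a ∷ p ∷ ps) extended (~-sym aw ∷ ap ∷ l) e rest) (n≤1+n _))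
      where
      extended : Unique (w ∷ a ∷ p ∷ ps)
      extended = ((λ w≡a → ~-irrefl aw (sym w≡a)) ∷ w≢p ∷ AllP.¬Any⇒All¬ ps w∉ps) ∷ a∉ ∷ u

    path-shortest′ : ∀ {a b k} xs → Unique (a ∷ xs) → Linked _~_ (a ∷ xs) → last (a ∷ xs) ≡ just b
                   → Wi a b k → length xs ≤ k
    path-shortest′ xs u l e (m , m≤k , p) = ≤-trans (path-shortest xs u l e p) m≤k

    record Line (g : ℕ → Vertex) (d : ℕ) : Set where
      field
        step-adj : ∀ j → j < d → g j ~ g (suc j)
        injective : ∀ j k → j ≤ d → k ≤ d → g j ≡ g k → j ≡ k

    open Line

    reverse-line : ∀ {g d} → Line g d → Line (λ j → g (d ∸ j)) d
    reverse-line {g} {d} line = record { step-adj = adjacent ; injective = inj }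
      where
      pred-step : ∀ {j} → j < d → d ∸ j ≡ suc (d ∸ suc j)
      pred-step j<d = +-∸-assoc 1 j<d
      adjacent : ∀ j → j < d → g (d ∸ j) ~ g (d ∸ suc j)
      adjacent j j<d = subst (λ k → g k ~ g (d ∸ suc j)) (sym (pred-step j<d))
        (~-sym (step-adj line (d ∸ suc j) (≤-trans (≤-reflexive (sym (pred-step j<d))) (m∸n≤m d j))))
      inj : ∀ j k → j ≤ d → k ≤ d → g (d ∸ j) ≡ g (d ∸ k) → j ≡ k
      inj j k j≤d k≤d eq = ∸-cancelˡ-≡ j≤d k≤d (injective line _ _ (m∸n≤m d j) (m∸n≤m d k) eq)

    through : (ℕ → Vertex) → ℕ → List Vertex → List Vertex
    through g zero xs = xs
    through g (suc c) xs = g 1 ∷ through (g ∘ suc) c xs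

    through-length : ∀ g c xs → length (through g c xs) ≡ c + length xs
    through-length g zero xs = refl
    through-length g (suc c) xs = cong suc (through-length (g ∘ suc) c xs)

    through-last : ∀ g c xs → last (g 0 ∷ through g c xs) ≡ last (g c ∷ xs)
    through-last g zero xs = refl
    through-last g (suc c) xs = through-last (g ∘ suc) c xs

    through-linked : ∀ g c xs → (∀ j → j < c → g j ~ g (suc j)) → Linked _~_ (g c ∷ xs)
                   → Linked _~_ (g 0 ∷ through g c xs)
    through-linked g zero xs _ l = l
    through-linked g (suc c) xs adj l =
      adj 0 (s≤s z≤n) ∷ through-linked (g ∘ suc) c xs (λ j j<c → adj (suc j) (s≤s j<c)) l

    through-all : ∀ {Q : Vertex → Set} g c xs → (∀ j → j < c → Q (g (suc j))) → All Q xs → All Q (through g c xs)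
    through-all g zero xs _ qs = qs
    through-all g (suc c) xs q qs = q 0 (s≤s z≤n) ∷ through-all (g ∘ suc) c xs (λ j j<c → q (suc j) (s≤s j<c)) qs

    through-unique : ∀ g c xs → (∀ j k → j ≤ c → k ≤ c → g j ≡ g k → j ≡ k) → All (λ t → ∀ j → g j ≢ t) xs
                   → Unique (g c ∷ xs) → Unique (g 0 ∷ through g c xs)
    through-unique g zero xs _ _ u = u
    through-unique g (suc c) xs inj off u = head-fresh ∷ through-unique (g ∘ suc) c xs inj′ off′ u
      where
      head-fresh : All (g 0 ≢_) (through g (suc c) xs)
      head-fresh = through-all g (suc c) xs (λ j j<c eq → 0≢1+n (inj 0 (suc j) z≤n j<c eq)) (All.map (λ off-t → off-t 0) off)
      inj′ : ∀ j k → j ≤ c → k ≤ c → g (suc j) ≡ g (suc k) → j ≡ k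
      inj′ j k j≤c k≤c eq = suc-injective (inj (suc j) (suc k) (s≤s j≤c) (s≤s k≤c) eq)
      off′ : All (λ t → ∀ j → g (suc j) ≢ t) xs
      off′ = All.map (λ off-t j → off-t (suc j)) off

    Branch : (ℕ → Vertex) → ℕ → Vertex → Set
    Branch g J z = Σ (List Vertex) λ xs → Unique (g J ∷ xs) × Linked _~_ (g J ∷ xs)
                     × All (λ t → ∀ j → g j ≢ t) xs × last (g J ∷ xs) ≡ just z

    branch-length : ∀ {g J z} → (b : Branch g J z) → z ≢ g J → ¬ z ~ g J → 2 ≤ length (proj₁ b)
    branch-length ([] , _ , _ , _ , refl) z≢gJ _ = ⊥-elim (z≢gJ refl)
    branch-length (_ ∷ [] , _ , e ∷ [-] , _ , refl) _ z≁gJ = ⊥-elim (z≁gJ (~-sym e))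
    branch-length (_ ∷ _ ∷ _ , _) _ _ = s≤s (s≤s z≤n)

    module _ {g : ℕ → Vertex} {d : ℕ} (line : Line g d) where

      adjacent-below : ∀ {J} → J ≤ d → ∀ j → j < J → g j ~ g (suc j)
      adjacent-below J≤d j j<J = step-adj line j (<-≤-trans j<J J≤d)

      branch-distance : ∀ {J z k} → J ≤ d → (b : Branch g J z) → Wi (g 0) z k → J + length (proj₁ b) ≤ k
      branch-distance {J} {z} {k} J≤d (xs , u , l , off , e) w =
        subst (_≤ k) (through-length g J xs)
          (path-shortest′ (through g J xs) (through-unique g J xs inj off u)
            (through-linked g J xs (adjacent-below J≤d) l) (trans (through-last g J xs) e) w)
        where
        inj : ∀ j k → j ≤ J → k ≤ J → g j ≡ g k → j ≡ k
        inj j k j≤J k≤J = injective line j k (≤-trans j≤J J≤d) (≤-trans k≤J J≤d)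

      line-walk : ∀ {J} → J ≤ d → Wi (g 0) (g J) J
      line-walk {J} J≤d = J , ≤-refl ,
        subst (Walk G (g 0) (g J)) (trans (through-length g J []) (+-identityʳ J))
          (linked-walk (through g J []) (through-linked g J [] (adjacent-below J≤d) [-]) (through-last g J []))

      line-distance : ∀ {J k} → J ≤ d → Wi (g 0) (g J) k → J ≤ k
      line-distance {J} {k} J≤d w =
        subst (_≤ k) (+-identityʳ J) (branch-distance J≤d ([] , [] ∷ [] , [-] , [] , refl) w)

      branch-far : ∀ {J z k} → J ≤ d → Branch g J z → z ≢ g J → ¬ z ~ g J → Wi (g 0) z k → J + 2 ≤ k
      branch-far {J} J≤d b z≢gJ z≁gJ w = ≤-trans (+-monoʳ-≤ J (branch-length b z≢gJ z≁gJ)) (branch-distance J≤d b w)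

      near-line : ∀ {r s} → r ≤ d → s ~ g r → Wi (g 0) s (suc r)
      near-line {r} r≤d e = subst (Wi (g 0) _) (+-comm r 1) (within-trans (line-walk r≤d) (~⇒within-one (~-sym e)))

      unheard : ∀ {S r u j} → (∀ {s} → s ∈ S → ¬ Wi (g 0) s r) → suc j ≤ r → Wi (g 0) u j → ¬ Heard S u
      unheard {r = r} {j = j} outside j<r w (s , s∈S , ws) =
        outside s∈S (within-mono (subst (_≤ r) (+-comm 1 j) j<r) (within-trans w (within-sym ws)))

      -- The power of the end g 0, given a list S of power-1 broadcasters outside the
      -- ball B(g 0, r): either g 0 keeps power r, or it drops to r - 1 because the
      -- vertices at distance exactly r are all heard by S, witnessed by a member of S
      -- adjacent to g r.
      record EndPower (S : List Vertex) (r : ℕ) : Set where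
        field
          power : ℕ
          witnesses : List Vertex
          power+witnesses : power + length witnesses ≡ r
          at-most-one : length witnesses ≤ 1
          1≤power : 1 ≤ power
          covers : ∀ u → Wi (g 0) u r → Wi (g 0) u power ⊎ Heard S u
          private-vertex : Σ Vertex λ u → Wi (g 0) u power × ¬ Heard S u
                             × (∀ k → 1 ≤ k → k < power → ¬ Wi (g 0) u k)
          witnessed : All (λ s → s ∈ S × s ~ g r) witnesses

      -- For r = 1, g 0 is its own private vertex.  For r ≥ 2, search for a vertex at
      -- distance exactly r that S does not hear: it is private for power r; if there is
      -- none, power r - 1 suffices and g (r - 1) is private.
      end-power : ∀ S r → 1 ≤ r → r ≤ d → (∀ {s} → s ∈ S → ¬ Wi (g 0) s r) → EndPower S r
      end-power S (suc zero) _ _ outside = record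
        { power = 1 ; witnesses = [] ; power+witnesses = refl ; at-most-one = z≤n ; 1≤power = ≤-refl
        ; covers = λ _ w → inj₁ w
        ; private-vertex = g 0 , within-refl 1 , unheard outside ≤-refl (within-refl 0) , λ k 1≤k k<1 _ → <⇒≱ k<1 1≤k
        ; witnessed = [] }
      end-power S r@(suc (suc r₀)) _ r≤d outside
        with FinP.any? (λ u → (within? r (g 0) u ×-dec ¬? (within? (suc r₀) (g 0) u)) ×-dec ¬? (heard? S u))
      ... | yes (u , (w , ¬w′) , ¬heard) = record
        { power = r ; witnesses = [] ; power+witnesses = +-identityʳ r ; at-most-one = z≤n ; 1≤power = s≤s z≤n
        ; covers = λ _ w → inj₁ w
        ; private-vertex = u , w , ¬heard , λ k _ k<r w″ → ¬w′ (within-mono (≤-pred k<r) w″)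
        ; witnessed = [] }
      ... | no none = record
        { power = suc r₀ ; witnesses = proj₁ witness ∷ [] ; power+witnesses = +-comm (suc r₀) 1 ; at-most-one = ≤-refl
        ; 1≤power = s≤s z≤n
        ; covers = covers
        ; private-vertex = g (suc r₀) , line-walk r₀<d , unheard outside ≤-refl (line-walk r₀<d)
                           , λ k _ k<r w → <⇒≱ k<r (line-distance r₀<d w)
        ; witnessed = proj₂ witness ∷ [] }
        where
        r₀<d : suc r₀ ≤ d
        r₀<d = ≤-trans (n≤1+n _) r≤d
        -- a vertex at distance exactly r that no member of S hears would be a
        -- vertex found by the search
        covers : ∀ u → Wi (g 0) u r → Wi (g 0) u (suc r₀) ⊎ Heard S u
        covers u w with within? (suc r₀) (g 0) u | heard? S u
        ... | yes w′ | _ = inj₁ w′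
        ... | no _ | yes heard = inj₂ heard
        ... | no ¬w′ | no ¬heard = ⊥-elim (none (u , (w , ¬w′) , ¬heard))
        -- in particular g r is heard, and not by itself (it lies in the ball)
        boundary-heard : Heard S (g r)
        boundary-heard with covers (g r) (line-walk r≤d)
        ... | inj₁ w = ⊥-elim (1+n≰n (line-distance r≤d w))
        ... | inj₂ heard = heard
        witness : Σ Vertex λ s → s ∈ S × s ~ g r
        witness with boundary-heard
        ... | s , s∈S , ws with within-one ws
        ...   | inj₁ refl = ⊥-elim (outside s∈S (line-walk r≤d))
        ...   | inj₂ e = s , s∈S , e

module Construction (T : Graph) (tree : IsTree T) (d : ℕ)
  (P : Fin (suc d) → V T) (path : IsPathOfLength T d P)
  (i : Fin (suc d)) (2≤i : 2 ≤ toℕ i) (i+2≤d : toℕ i + 2 ≤ d)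
  (x y : V T) (x∈Tᵢ : InBranch T P i x) (y∈Tᵢ : InBranch T P i y)
  (x≢y : x ≢ y) (x≁y : ¬ Adj T x y)
  (x≢vᵢ : x ≢ P i) (x≁vᵢ : ¬ Adj T x (P i)) (y≢vᵢ : y ≢ P i) (y≁vᵢ : ¬ Adj T y (P i)) where

  open GraphTheory T
  open Distances (proj₁ tree)
  open Trees (proj₂ (proj₂ tree))

  -- the radii of the two end balls: a = i - 1 and b = d - i, so that a + b + 1 = d
  I a b : ℕ
  I = toℕ i
  a = I ∸ 1
  b = d ∸ I

  I≤d : I ≤ d
  I≤d = ≤-trans (m≤m+n I 2) i+2≤d

  1+a≡I : suc a ≡ I
  1+a≡I = sym (+-∸-assoc 1 (≤-trans (s≤s z≤n) 2≤i))

  1≤a : 1 ≤ a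
  1≤a = ∸-monoˡ-≤ 1 2≤i

  a≤d : a ≤ d
  a≤d = ≤-trans (m∸n≤m I 1) I≤d

  2≤b : 2 ≤ b
  2≤b = subst (_≤ b) (m+n∸m≡n I 2) (∸-monoˡ-≤ I i+2≤d)

  1+a+b≡d : suc (a + b) ≡ d
  1+a+b≡d = trans (cong (_+ b) 1+a≡I) (m+[n∸m]≡n I≤d)

  -- node j = v_j, the path P indexed by naturals (clamped to v₀ beyond d)
  node : ℕ → Vertex
  node j with j <? suc d
  ... | yes j≤d = P (fromℕ< j≤d)
  ... | no _ = P fzero

  node-at : ∀ k {j} → toℕ k ≡ j → node j ≡ P k
  node-at k refl with toℕ k <? suc d
  ... | yes k≤d = cong P (FinP.fromℕ<-toℕ k k≤d)
  ... | no k≰d = ⊥-elim (k≰d (FinP.toℕ<n k))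

  node-on-path : ∀ j → OnPath T P (node j)
  node-on-path j with j <? suc d
  ... | yes j≤d = fromℕ< j≤d , refl
  ... | no _ = fzero , refl

  line : Line node d
  line = record { step-adj = adjacent ; injective = inj }
    where
    adjacent : ∀ j → j < d → node j ~ node (suc j)
    adjacent j j<d = subst₂ _~_ (sym (node-at (inject₁ k) (trans (FinP.toℕ-inject₁ k) (FinP.toℕ-fromℕ< j<d))))
                               (sym (node-at (fsuc k) (cong suc (FinP.toℕ-fromℕ< j<d))))
                               (proj₂ path k)
      where
      k : Fin d
      k = fromℕ< j<d
    inj : ∀ j k → j ≤ d → k ≤ d → node j ≡ node k → j ≡ k
    inj j k j≤d k≤d eq = begin
      j                      ≡⟨ sym (FinP.toℕ-fromℕ< (s≤s j≤d)) ⟩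
      toℕ (fromℕ< (s≤s j≤d)) ≡⟨ cong toℕ (proj₁ path _ _ P-eq) ⟩
      toℕ (fromℕ< (s≤s k≤d)) ≡⟨ FinP.toℕ-fromℕ< (s≤s k≤d) ⟩
      k                      ∎
      where
      open ≡-Reasoning
      P-eq : P (fromℕ< (s≤s j≤d)) ≡ P (fromℕ< (s≤s k≤d))
      P-eq = trans (sym (node-at _ (FinP.toℕ-fromℕ< (s≤s j≤d)))) (trans eq (node-at _ (FinP.toℕ-fromℕ< (s≤s k≤d))))

  node′ : ℕ → Vertex
  node′ j = node (d ∸ j)

  line′ : Line node′ d
  line′ = reverse-line line

  v₀ vd : Vertex
  v₀ = node 0
  vd = node d

  v₀≢vd : v₀ ≢ vd
  v₀≢vd eq = <⇒≢ 0<d (Line.injective line 0 d z≤n ≤-refl eq)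
    where
    0<d : 0 < d
    0<d = ≤-trans (s≤s z≤n) (≤-trans (m≤n+m 2 I) i+2≤d)

  -- the balls B(v₀, a) and B(v_d, b) are disjoint, since a + b < d = d(v₀, v_d)
  disjoint-balls : ∀ {u j k} → j ≤ a → k ≤ b → Wi v₀ u j → Wi vd u k → ⊥
  disjoint-balls j≤a k≤b w₀ wd =
    <⇒≱ (subst (suc _ ≤_) 1+a+b≡d (s≤s (+-mono-≤ j≤a k≤b)))
        (line-distance line ≤-refl (within-trans w₀ (within-sym wd)))

  -- x and y hang at v_i, which is node I seen from v₀ and node′ b seen from v_d
  as-branch : ∀ (g : ℕ → Vertex) J {z} → g J ≡ P i → (∀ j → OnPath T P (g j)) → InBranch T P i z → Branch g J z
  as-branch g J gJ≡vᵢ on (xs , u , l , off , e) =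
    xs , subst (λ t → Unique (t ∷ xs)) (sym gJ≡vᵢ) u , subst (λ t → Linked _~_ (t ∷ xs)) (sym gJ≡vᵢ) l
       , All.map (λ off-t j eq → off-t (subst (OnPath T P) eq (on j))) off
       , subst (λ t → last (t ∷ xs) ≡ just _) (sym gJ≡vᵢ) e

  node-I : node I ≡ P i
  node-I = node-at i refl

  node′-b : node′ b ≡ node I
  node′-b = cong node (m∸[m∸n]≡n I≤d)

  record Deep (z : Vertex) : Set where
    field
      from-v₀ : ∀ {k} → Wi v₀ z k → I + 2 ≤ k
      from-vd : ∀ {k} → Wi vd z k → b + 2 ≤ k

  deep : ∀ {z} → InBranch T P i z → z ≢ P i → ¬ z ~ P i → Deep z
  deep z∈Tᵢ z≢vᵢ z≁vᵢ = record
    { from-v₀ = branch-far line I≤d (as-branch node I node-I node-on-path z∈Tᵢ)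
                  (λ eq → z≢vᵢ (trans eq node-I)) (λ e → z≁vᵢ (subst (_ ~_) node-I e))
    ; from-vd = branch-far line′ (m∸n≤m d I) (as-branch node′ b (trans node′-b node-I) (node-on-path ∘ (d ∸_)) z∈Tᵢ)
                  (λ eq → z≢vᵢ (trans eq (trans node′-b node-I))) (λ e → z≁vᵢ (subst (_ ~_) (trans node′-b node-I) e)) }

  deep-x : Deep x
  deep-x = deep x∈Tᵢ x≢vᵢ x≁vᵢ

  deep-y : Deep y
  deep-y = deep y∈Tᵢ y≢vᵢ y≁vᵢ

  Outside : Vertex → Set
  Outside u = ¬ Wi v₀ u a × ¬ Wi vd u b

  deep-outside : ∀ {z} → Deep z → Outside z
  deep-outside D = (λ w → beyond (Deep.from-v₀ D) (m∸n≤m I 1) (within-mono (n≤1+n a) w))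
                 , (λ w → beyond (Deep.from-vd D) ≤-refl (within-mono (n≤1+n b) w))

  open Greedy Outside (λ u → ¬? (within? a v₀ u) ×-dec ¬? (within? b vd u))

  seeds : List Vertex
  seeds = y ∷ x ∷ []

  S : List Vertex
  S = greedy seeds (allFin (n T))

  seeds-independent : IndependentIn seeds
  seeds-independent = outside , independent
    where
    outside : ∀ {c} → c ∈ seeds → Outside c
    outside (here refl) = deep-outside deep-y
    outside (there (here refl)) = deep-outside deep-x
    independent : ∀ {c c′} → c ∈ seeds → c′ ∈ seeds → ¬ c ~ c′
    independent (here refl) (here refl) e = ~-irrefl e refl
    independent (here refl) (there (here refl)) e = x≁y (~-sym e)
    independent (there (here refl)) (here refl) e = x≁y e
    independent (there (here refl)) (there (here refl)) e = ~-irrefl e refl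

  S-independent : IndependentIn S
  S-independent = greedy-independent seeds (allFin (n T)) seeds-independent

  S-outside : ∀ {s} → s ∈ S → Outside s
  S-outside = proj₁ S-independent

  x∈S : x ∈ S
  x∈S = greedy-⊇ seeds (allFin (n T)) (there (here refl))

  y∈S : y ∈ S
  y∈S = greedy-⊇ seeds (allFin (n T)) (here refl)

  v₀∉S : v₀ ∉ S
  v₀∉S v₀∈S = proj₁ (S-outside v₀∈S) (within-refl a)

  vd∉S : vd ∉ S
  vd∉S vd∈S = proj₂ (S-outside vd∈S) (within-refl b)

  end₀ : EndPower line S a
  end₀ = end-power line S a 1≤a a≤d (proj₁ ∘ S-outside)

  endd : EndPower line′ S b
  endd = end-power line′ S b (≤-trans (s≤s z≤n) 2≤b) (m∸n≤m d I) (proj₂ ∘ S-outside)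

  module E₀ = EndPower end₀
  module Ed = EndPower endd

  a′ b′ : ℕ
  a′ = E₀.power
  b′ = Ed.power

  a′≤a : a′ ≤ a
  a′≤a = subst (a′ ≤_) E₀.power+witnesses (m≤m+n a′ _)

  b′≤b : b′ ≤ b
  b′≤b = subst (b′ ≤_) Ed.power+witnesses (m≤m+n b′ _)

  h : Broadcast T
  h w = δ v₀ a′ w + δ vd b′ w + ind S w

  h≡ : ∀ {w p q r} → δ v₀ a′ w ≡ p → δ vd b′ w ≡ q → ind S w ≡ r → h w ≡ p + q + r
  h≡ e₁ e₂ e₃ = cong₂ _+_ (cong₂ _+_ e₁ e₂) e₃

  h-v₀ : h v₀ ≡ a′
  h-v₀ = trans (h≡ (δ-at v₀ a′) (δ-off b′ v₀≢vd) (ind-out v₀∉S)) (trans (+-identityʳ _) (+-identityʳ _))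

  h-vd : h vd ≡ b′
  h-vd = trans (h≡ (δ-off a′ (v₀≢vd ∘ sym)) (δ-at vd b′) (ind-out vd∉S)) (+-identityʳ _)

  h-S : ∀ {s} → s ∈ S → h s ≡ 1
  h-S s∈S = h≡ (δ-off a′ (λ eq → v₀∉S (subst (_∈ S) eq s∈S))) (δ-off b′ (λ eq → vd∉S (subst (_∈ S) eq s∈S))) (ind-in s∈S)

  Centre : Vertex → Set
  Centre w = w ≡ v₀ ⊎ w ≡ vd ⊎ w ∈ S

  centres : ∀ w → 1 ≤ h w → Centre w
  centres w 1≤hw = classify (w FinP.≟ v₀) (w FinP.≟ vd) (Any.any? (w FinP.≟_) S)
    where
    classify : Dec (w ≡ v₀) → Dec (w ≡ vd) → Dec (w ∈ S) → Centre w
    classify (yes e) _ _ = inj₁ e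
    classify (no _) (yes e) _ = inj₂ (inj₁ e)
    classify (no _) (no _) (yes w∈S) = inj₂ (inj₂ w∈S)
    classify (no w≢v₀) (no w≢vd) (no w∉S) =
      ⊥-elim (1+n≰n (subst (1 ≤_) (h≡ (δ-off a′ w≢v₀) (δ-off b′ w≢vd) (ind-out w∉S)) 1≤hw))

  only-hearer : ∀ {u c} → (v₀ ≢ c → ¬ Wi v₀ u a′) → (vd ≢ c → ¬ Wi vd u b′) → (∀ {s} → s ∈ S → s ≢ c → ¬ Wi s u 1)
              → ∀ w → 1 ≤ h w → Wi w u (h w) → w ≡ c
  only-hearer {u} {c} ¬v₀ ¬vd ¬S w 1≤hw hears with centres w 1≤hw
  ... | inj₁ refl = decidable-stable (v₀ FinP.≟ c) (λ v₀≢c → ¬v₀ v₀≢c (subst (Wi v₀ u) h-v₀ hears))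
  ... | inj₂ (inj₁ refl) = decidable-stable (vd FinP.≟ c) (λ vd≢c → ¬vd vd≢c (subst (Wi vd u) h-vd hears))
  ... | inj₂ (inj₂ w∈S) = decidable-stable (w FinP.≟ c) (λ w≢c → ¬S w∈S w≢c (subst (Wi w u) (h-S w∈S) hears))

  -- the private vertices of v₀ and v_d come from the choice of their powers: the
  -- balls are disjoint and the vertex is not heard by S
  private-v₀ : ∃ (Private h v₀)
  private-v₀ with E₀.private-vertex
  ... | u , w₀ , ¬heard , far =
    u , only-hearer (λ v₀≢v₀ _ → v₀≢v₀ refl) (λ _ wd → disjoint-balls a′≤a b′≤b w₀ wd) (λ s∈S _ ws → ¬heard (_ , s∈S , ws))
      , λ k 1≤k k<h → far k 1≤k (subst (k <_) h-v₀ k<h)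

  private-vd : ∃ (Private h vd)
  private-vd with Ed.private-vertex
  ... | u , wd , ¬heard , far =
    u , only-hearer (λ _ w₀ → disjoint-balls a′≤a b′≤b w₀ wd) (λ vd≢vd _ → vd≢vd refl) (λ s∈S _ ws → ¬heard (_ , s∈S , ws))
      , λ k 1≤k k<h → far k 1≤k (subst (k <_) h-vd k<h)

  -- a member of S is its own private vertex: it is outside both balls, and S is independent
  private-S : ∀ {s} → s ∈ S → ∃ (Private h s)
  private-S {s} s∈S =
    s , only-hearer (λ _ w → proj₁ (S-outside s∈S) (within-mono a′≤a w)) (λ _ w → proj₂ (S-outside s∈S) (within-mono b′≤b w))
                    (λ s′∈S s′≢s ws′ → [ s′≢s , proj₂ S-independent s′∈S s∈S ]′ (within-one ws′))
      , λ k 1≤k k<1 _ → <⇒≱ (subst (k <_) (h-S s∈S) k<1) 1≤k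

  privates : ∀ w → 1 ≤ h w → ∃ (Private h w)
  privates w 1≤hw with centres w 1≤hw
  ... | inj₁ refl = private-v₀
  ... | inj₂ (inj₁ refl) = private-vd
  ... | inj₂ (inj₂ w∈S) = private-S w∈S

  h-is-broadcast : IsBroadcast T h
  h-is-broadcast = broadcast-within-eccentricity h
    (λ w 1≤hw → private⇒reaches (proj₁ (proj₂ tree)) h w 1≤hw (privates w 1≤hw))

  Hears : Vertex → Set
  Hears u = Σ Vertex λ w → 1 ≤ h w × Wi w u (h w)

  heard-by-v₀ : ∀ {u} → Wi v₀ u a′ → Hears u
  heard-by-v₀ w = v₀ , subst (1 ≤_) (sym h-v₀) E₀.1≤power , subst (Wi v₀ _) (sym h-v₀) w

  heard-by-vd : ∀ {u} → Wi vd u b′ → Hears u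
  heard-by-vd w = vd , subst (1 ≤_) (sym h-vd) Ed.1≤power , subst (Wi vd _) (sym h-vd) w

  heard-by-S : ∀ {u} → Heard S u → Hears u
  heard-by-S (s , s∈S , w) = s , subst (1 ≤_) (sym (h-S s∈S)) ≤-refl , subst (Wi s _) (sym (h-S s∈S)) w

  -- every vertex is in one of the end balls (and heard by its end or by S), or is
  -- outside both (and then is in S or adjacent to S by maximality)
  h-dominating : Dominating T h
  h-dominating u with within? a v₀ u | within? b vd u
  ... | yes w | _ = [ heard-by-v₀ , heard-by-S ]′ (E₀.covers u w)
  ... | no _ | yes w = [ heard-by-vd , heard-by-S ]′ (Ed.covers u w)
  ... | no ¬w₀ | no ¬wd with greedy-maximal seeds (allFin (n T)) (∈-allFin u) (¬w₀ , ¬wd)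
  ...   | inj₁ u∈S = heard-by-S (u , u∈S , within-refl 1)
  ...   | inj₂ (s , s∈S , s~u) = heard-by-S (s , s∈S , ~⇒within-one s~u)

  -- The witnesses of the two ends; each is adjacent to v_{i-1} or to v_i.
  witnesses : List Vertex
  witnesses = E₀.witnesses ++ Ed.witnesses

  -- a witness lies within distance a + 1 of v₀ or b + 1 of v_d, so it is not deep in T_i
  witness-not-deep : ∀ {z s} → Deep z → s ∈ witnesses → z ≢ s
  witness-not-deep D s∈W refl with ∈-++⁻ E₀.witnesses s∈W
  ... | inj₁ s∈W₀ = beyond (Deep.from-v₀ D) (m∸n≤m I 1) (near-line line a≤d (proj₂ (All.lookup E₀.witnessed s∈W₀)))
  ... | inj₂ s∈Wd = beyond (Deep.from-vd D) ≤-refl (near-line line′ (m∸n≤m d I) (proj₂ (All.lookup Ed.witnessed s∈Wd)))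

  -- a witness of both ends would close the triangle v_{i-1} v_i s
  witnesses-disjoint : Disjoint E₀.witnesses Ed.witnesses
  witnesses-disjoint (s∈W₀ , s∈Wd) = no-triangle vᵢ₋₁~vᵢ (~-sym s~vᵢ) s~vᵢ₋₁
    where
    s~vᵢ₋₁ : _ ~ node a
    s~vᵢ₋₁ = proj₂ (All.lookup E₀.witnessed s∈W₀)
    s~vᵢ : _ ~ node I
    s~vᵢ = subst (_ ~_) node′-b (proj₂ (All.lookup Ed.witnessed s∈Wd))
    vᵢ₋₁~vᵢ : node a ~ node I
    vᵢ₋₁~vᵢ = subst (λ j → node a ~ node j) 1+a≡I (Line.step-adj line a (subst (_≤ d) (sym 1+a≡I) I≤d))

  counted : List Vertex
  counted = x ∷ y ∷ witnesses

  counted-unique : Unique counted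
  counted-unique = (x≢y ∷ All.tabulate (witness-not-deep deep-x))
                 ∷ All.tabulate (witness-not-deep deep-y)
                 ∷ UniqueP.++⁺ (short-unique _ E₀.at-most-one) (short-unique _ Ed.at-most-one) witnesses-disjoint

  counted-⊆-S : ∀ {w} → w ∈ counted → w ∈ S
  counted-⊆-S (here refl) = x∈S
  counted-⊆-S (there (here refl)) = y∈S
  counted-⊆-S (there (there s∈W)) =
    [ (λ s∈W₀ → proj₁ (All.lookup E₀.witnessed s∈W₀)) , (λ s∈Wd → proj₁ (All.lookup Ed.witnessed s∈Wd)) ]′
      (∈-++⁻ E₀.witnesses s∈W)

  total-h : total h ≡ a′ + b′ + total (ind S)
  total-h = begin
    total h                                               ≡⟨ total-+ (λ w → δ v₀ a′ w + δ vd b′ w) (ind S) ⟩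
    total (λ w → δ v₀ a′ w + δ vd b′ w) + total (ind S)   ≡⟨ cong (_+ total (ind S)) (total-+ (δ v₀ a′) (δ vd b′)) ⟩
    total (δ v₀ a′) + total (δ vd b′) + total (ind S)     ≡⟨ cong₂ (λ p q → p + q + total (ind S)) (total-δ v₀ a′) (total-δ vd b′) ⟩
    a′ + b′ + total (ind S)                               ∎
    where open ≡-Reasoning

  rearrange : ∀ p q r s → 2 + ((p + r) + (q + s)) ≡ p + q + (2 + (r + s))
  rearrange = solve-∀

  d<cost : d < cost T h
  d<cost = begin-strict
    d                                        ≡⟨ sym 1+a+b≡d ⟩
    suc (a + b)                              <⟨ n<1+n _ ⟩
    2 + (a + b)                              ≡⟨ cong₂ (λ p q → 2 + (p + q)) (sym E₀.power+witnesses) (sym Ed.power+witnesses) ⟩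
    2 + ((a′ + w₀) + (b′ + wd))              ≡⟨ rearrange a′ b′ w₀ wd ⟩
    a′ + b′ + (2 + (w₀ + wd))                ≡⟨ cong (λ t → a′ + b′ + (2 + t)) (sym (length-++ E₀.witnesses)) ⟩
    a′ + b′ + length counted                 ≤⟨ +-monoʳ-≤ (a′ + b′) (unique-count counted S counted-unique counted-⊆-S) ⟩
    a′ + b′ + total (ind S)                  ≡⟨ sym total-h ⟩
    total h                                  ≡⟨ sym (cong sum (map-tabulate id h)) ⟩
    cost T h                                 ∎
    where
    open ≤-Reasoning
    w₀ wd : ℕ
    w₀ = length E₀.witnesses
    wd = length Ed.witnesses

lemma3p3 : (T : Graph) → IsTree T → (d : ℕ) → Diam T d
    → (P : Fin (suc d) → V T) → IsPathOfLength T d P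
    → (i : Fin (suc d)) → 2 ≤ toℕ i → toℕ i + 2 ≤ d
    → (x y : V T) → InBranch T P i x → InBranch T P i y
    → x ≢ y → ¬ Adj T x y
    → x ≢ P i → ¬ Adj T x (P i) → y ≢ P i → ¬ Adj T y (P i)
    → UpperBroadcastNumberExceeds T d
lemma3p3 T tree d _ P path i 2≤i i+2≤d x y x∈Tᵢ y∈Tᵢ x≢y x≁y x≢vᵢ x≁vᵢ y≢vᵢ y≁vᵢ =
  h , (h-is-broadcast , h-dominating , privates⇒minimal h privates) , d<cost
  where
  open Construction T tree d P path i 2≤i i+2≤d x y x∈Tᵢ y∈Tᵢ x≢y x≁y x≢vᵢ x≁vᵢ y≢vᵢ y≁vᵢ
  open GraphTheory T using (privates⇒minimal)
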